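{- Let $a,b,c$ be positive integers and $g=\gcd(a+c,b+c)$. The game $(\{a,b\},\{c\})$ is: (i) strongly dominated by Left if $g\le c$; (ii) weakly dominated by Left, with period $\mathcal P^{g-c}\mathcal L^{2c-g}\mathcal N^{g-c}$, if $c<g<2c$; (iii) ultimately impartial, with period $\mathcal P^c\mathcal N^c$, if $g=2c$; (iv) weakly dominated by Right, with period $\mathcal P^c\mathcal R^{g-2c}\mathcal N^c$, if $g>2c$.
   Context: A partizan subtraction game $(S_L,S_R)$, with $S_L,S_R$ finite sets of positive integers, is played on a heap of $n$ tokens. Two players, Left and Right, alternate moves; Left removes $s\in S_L$ tokens and Right removes $s\in S_R$ tokens (at most the current heap size). A player unable to move loses. The outcome $o(n)$ is $\mathcal L$ (Left wins whoever starts), $\mathcal R$ (Right wins whoever starts), $\mathcal N$ (first player wins) or $\mathcal P$ (second player wins). The outcome sequence $o(0),o(1),\ldots$ is ultimately periodic; "period $w$" means a block of consecutive outcomes in the periodic part of length equal to the period is the word $w$ (up to cyclic rotation). Strongly dominated by Left: $o(n)=\mathcal L$ for all large $n$. Weakly dominated by Left (resp. Right): the period contains at least one $\mathcal L$ and no $\mathcal R$ (resp. at least one $\mathcal R$ and no $\mathcal L$). Ultimately impartial: the period contains neither $\mathcal L$ nor $\mathcal R$. -}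

module Defs where

open import Data.Nat using (ℕ; zero; suc; _+_; _*_; _∸_; _≤_; _<_)
open import Data.Bool using (Bool; true; false; not; _∧_; _∨_)
open import Data.List using (List; []; _∷_; _++_; replicate; length)
open import Data.Maybe using (Maybe; just; nothing)
open import Data.Product using (_×_; _,_; proj₁; proj₂; ∃-syntax)
open import Relation.Binary.PropositionalEquality using (_≡_; _≢_)

data Outcome : Set where
  𝓛 𝓡 𝓝 𝓟 : Outcome

nth : {A : Set} → List A → ℕ → Maybe A
nth []       _       = nothing
nth (x ∷ xs) zero    = just x
nth (x ∷ xs) (suc i) = nth xs i

-- An entry (lw , rw): lw = "Left wins moving first", rw = "Right wins moving first".
Entry : Set
Entry = Bool × Bool

-- Does some move s ∈ S (s positive, s ≤ heap) lead to a position where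
-- the opponent, moving first, loses?  `hist` lists entries of positions
-- n, n-1, ..., 0 (so removing s ≥ 1 from heap n+1 reaches index s-1).
-- `opp` extracts the opponent's "wins moving first" bit.
canWin : (Entry → Bool) → List ℕ → List Entry → Bool
canWin opp []            hist = false
canWin opp (zero ∷ S)    hist = canWin opp S hist   -- 0 is not a legal move
canWin opp (suc k ∷ S)   hist with nth hist k
... | just e  = not (opp e) ∨ canWin opp S hist
... | nothing = canWin opp S hist

history : List ℕ → List ℕ → ℕ → List Entry
history SL SR zero    = (false , false) ∷ []
history SL SR (suc n) =
  (canWin proj₂ SL h , canWin proj₁ SR h) ∷ h
  where h = history SL SR n

entryToOutcome : Entry → Outcome
entryToOutcome (true  , false) = 𝓛
entryToOutcome (false , true)  = 𝓡
entryToOutcome (true  , true)  = 𝓝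
entryToOutcome (false , false) = 𝓟

headEntry : List Entry → Entry
headEntry []      = (false , false)
headEntry (e ∷ _) = e

outcome : List ℕ → List ℕ → ℕ → Outcome
outcome SL SR n = entryToOutcome (headEntry (history SL SR n))

StronglyLeft : (ℕ → Outcome) → Set
StronglyLeft o = ∃[ n₀ ] (∀ n → n₀ ≤ n → o n ≡ 𝓛)

PeriodicFrom : (ℕ → Outcome) → ℕ → ℕ → Set
PeriodicFrom o n₀ p = (0 < p) × (∀ n → n₀ ≤ n → o (n + p) ≡ o n)

WeaklyLeft : (ℕ → Outcome) → Set
WeaklyLeft o = ∃[ n₀ ] ∃[ p ] (PeriodicFrom o n₀ p
  × (∃[ n ] (n₀ ≤ n × o n ≡ 𝓛)) × (∀ n → n₀ ≤ n → o n ≢ 𝓡))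

WeaklyRight : (ℕ → Outcome) → Set
WeaklyRight o = ∃[ n₀ ] ∃[ p ] (PeriodicFrom o n₀ p
  × (∃[ n ] (n₀ ≤ n × o n ≡ 𝓡)) × (∀ n → n₀ ≤ n → o n ≢ 𝓛))

UltImpartial : (ℕ → Outcome) → Set
UltImpartial o = ∃[ n₀ ] ∃[ p ] (PeriodicFrom o n₀ p
  × (∀ n → n₀ ≤ n → (o n ≢ 𝓛 × o n ≢ 𝓡)))

-- "period w": from some n₀ on, the sequence is w w w ... (so w, up to
-- cyclic rotation, is a block of length |w| in the periodic part, and
-- the sequence is periodic with period |w|).
HasPeriodWord : (ℕ → Outcome) → List Outcome → Set
HasPeriodWord o w = (0 < length w) × ∃[ n₀ ] (∀ k i → i < length w →
  nth w i ≡ just (o (n₀ + k * length w + i)))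

_^ʷ_ : Outcome → ℕ → List Outcome
x ^ʷ k = replicate k x

{-# OPTIONS --safe #-}
-- Right's only move c is forced, so a Left move s followed by Right's reply removes s + c
-- tokens. Hence Left, moving first, wins from n exactly when n ∈ [t − c, t) for some sum t of
-- the numbers A = a + c and B = b + c, and Right, moving first, wins from n exactly when
-- n ≥ c and Left loses moving first from n − c. Sums of A and B are multiples of
-- g = gcd(A, B), and by Bézout every large multiple of g is such a sum; so for large
-- n = q g + r (0 ≤ r < g) Left wins moving first iff g ≤ r + c, and, when c ≤ g, Right wins
-- moving first iff c ≤ r. The outcome is thus eventually a function of n mod g, and
-- tabulating it over the residues r < g yields the four cases.
module Submission where

open import Defs
open import Data.Nat
  using (ℕ; zero; suc; _+_; _*_; _∸_; _≤_; _<_; z≤n; s≤s; z<s; _≤?_; NonZero; ≢-nonZero; >-nonZero⁻¹)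
open import Data.Nat.Properties
open import Data.Nat.Induction using (<-rec)
open import Data.Nat.DivMod using (_/_; _%_; m≡m%n+[m/n]*n; m%n<n; m*n/n≡m; /-monoˡ-≤)
open import Data.Nat.Divisibility using (_∣_; divides; _∣0; ∣m∣n⇒∣m+n)
open import Data.Nat.GCD using (gcd; module Bézout; gcd-GCD; gcd[m,n]∣m; gcd[m,n]∣n; gcd[m,n]≢0)
open import Data.Nat.Tactic.RingSolver using (solve-∀)
open import Data.Bool using (Bool; true; false; not)
open import Data.Bool.Properties using (¬-not; not-injective)
open import Data.List using (List; []; _∷_; _++_; replicate; applyUpTo)
open import Data.List.Properties using (length-applyUpTo)
open import Data.List.Membership.Propositional using (_∈_; find; lose)
open import Data.List.Relation.Unary.Any using (Any; here; there; satisfied)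
open import Data.Maybe using (just; nothing)
open import Data.Product using (_×_; _,_; proj₁; proj₂; ∃-syntax)
open import Data.Sum using (_⊎_; inj₁; inj₂)
open import Data.Empty using (⊥-elim)
open import Function.Base using (_∘_; const; case_of_)
open import Function.Bundles using (_⇔_; mk⇔; Equivalence)
open import Relation.Binary.PropositionalEquality
open import Relation.Nullary using (yes; no; ¬_; does)
open import Relation.Nullary.Decidable using (dec-true; dec-false)

<⊎∃+ : ∀ c m → m < c ⊎ ∃[ k ] m ≡ c + k
<⊎∃+ zero    m       = inj₂ (m , refl)
<⊎∃+ (suc c) zero    = inj₁ z<s
<⊎∃+ (suc c) (suc m) with <⊎∃+ c m
... | inj₁ m<c        = inj₁ (s≤s m<c)
... | inj₂ (k , refl) = inj₂ (k , refl)

2*c≡c+c : ∀ c → 2 * c ≡ c + c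
2*c≡c+c c = cong (c +_) (+-identityʳ c)

divMod-≥ : ∀ g .{{_ : NonZero g}} {Q n} → Q * g ≤ n →
  ∃[ q ] ∃[ r ] (Q ≤ q × r < g × n ≡ q * g + r)
divMod-≥ g {Q} {n} Qg≤n =
  n / g , n % g , Q≤n/g , m%n<n n g , trans (m≡m%n+[m/n]*n n g) (+-comm (n % g) (n / g * g))
  where
  Q≤n/g : Q ≤ n / g
  Q≤n/g = subst (_≤ n / g) (m*n/n≡m Q g) (/-monoˡ-≤ g Qg≤n)

nth-applyUpTo : ∀ {A : Set} (f : ℕ → A) {n i} → i < n → nth (applyUpTo f n) i ≡ just (f i)
nth-applyUpTo f {suc n} {zero}  _       = refl
nth-applyUpTo f {suc n} {suc i} (s≤s p) = nth-applyUpTo (f ∘ suc) p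

applyUpTo-replicate : ∀ {A : Set} {f : ℕ → A} {x} m →
  (∀ i → i < m → f i ≡ x) → applyUpTo f m ≡ replicate m x
applyUpTo-replicate zero    _   = refl
applyUpTo-replicate (suc m) f≡x =
  cong₂ _∷_ (f≡x 0 z<s) (applyUpTo-replicate m λ i i<m → f≡x (suc i) (s≤s i<m))

applyUpTo-replicate-++ : ∀ {A : Set} {f : ℕ → A} {x} m n → (∀ i → i < m → f i ≡ x) →
  applyUpTo f (m + n) ≡ replicate m x ++ applyUpTo (f ∘ (m +_)) n
applyUpTo-replicate-++ zero    n _   = refl
applyUpTo-replicate-++ (suc m) n f≡x =
  cong₂ _∷_ (f≡x 0 z<s) (applyUpTo-replicate-++ m n λ i i<m → f≡x (suc i) (s≤s i<m))

applyUpTo-blocks : ∀ {A : Set} {f : ℕ → A} {x y z} p q s →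
  (∀ i → i < p → f i ≡ x) → (∀ i → i < q → f (p + i) ≡ y) → (∀ i → i < s → f (p + (q + i)) ≡ z) →
  applyUpTo f (p + (q + s)) ≡ replicate p x ++ replicate q y ++ replicate s z
applyUpTo-blocks {f = f} {x} {y} {z} p q s f≡x f≡y f≡z = begin
  applyUpTo f (p + (q + s))
    ≡⟨ applyUpTo-replicate-++ p (q + s) f≡x ⟩
  replicate p x ++ applyUpTo (f ∘ (p +_)) (q + s)
    ≡⟨ cong (replicate p x ++_) (applyUpTo-replicate-++ q s f≡y) ⟩
  replicate p x ++ replicate q y ++ applyUpTo (f ∘ (p +_) ∘ (q +_)) s
    ≡⟨ cong (λ w → replicate p x ++ replicate q y ++ w) (applyUpTo-replicate s f≡z) ⟩
  replicate p x ++ replicate q y ++ replicate s z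
    ∎
  where open ≡-Reasoning

data SumOf (G : ℕ → Set) : ℕ → Set where
  []  : SumOf G 0
  _∷_ : ∀ {s t} → G s → SumOf G t → SumOf G (s + t)

module _ {G : ℕ → Set} where

  SumOf-++ : ∀ {t u} → SumOf G t → SumOf G u → SumOf G (t + u)
  SumOf-++ []               τ = τ
  SumOf-++ (_∷_ {s} {t} x σ) τ = subst (SumOf G) (sym (+-assoc s t _)) (x ∷ SumOf-++ σ τ)

  SumOf-* : ∀ {s} → G s → ∀ u → SumOf G (u * s)
  SumOf-* x zero    = []
  SumOf-* x (suc u) = x ∷ SumOf-* x u

  SumOf-combination : ∀ {A B} → G A → G B → ∀ u v → SumOf G (u * A + v * B)
  SumOf-combination x y u v = SumOf-++ (SumOf-* x u) (SumOf-* y v)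

  SumOf-∣ : ∀ {d t} → (∀ {s} → G s → d ∣ s) → SumOf G t → d ∣ t
  SumOf-∣ d∣ []      = _ ∣0
  SumOf-∣ d∣ (x ∷ σ) = ∣m∣n⇒∣m+n (d∣ x) (SumOf-∣ d∣ σ)

Combination : ℕ → ℕ → ℕ → Set
Combination A B n = ∃[ u ] ∃[ v ] n ≡ u * A + v * B

Combination-comm : ∀ {A B n} → Combination A B n → Combination B A n
Combination-comm {A} {B} (u , v , n≡) = v , u , trans n≡ (+-comm (u * A) (v * B))

-- Write k = q B' + r with r < B'; then k g = r (g + y B) + (q ∸ r y) B = (r x) A + (q ∸ r y) B.
bézout⇒eventually-combination : ∀ {A B g x y B'} .{{_ : NonZero B'}} →
  g + y * B ≡ x * A → B ≡ B' * g → ∀ k → B' * y * B' ≤ k → Combination A B (k * g)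
bézout⇒eventually-combination {A} {B} {g} {x} {y} {B'} bézout B≡B'g k k≥ = r * x , d , k*g≡
  where
  r = k % B'
  q = k / B'
  d = q ∸ r * y
  ry≤q : r * y ≤ q
  ry≤q = ≤-trans (*-monoˡ-≤ y (<⇒≤ (m%n<n k B')))
                 (subst (_≤ q) (m*n/n≡m (B' * y) B') (/-monoˡ-≤ B' k≥))
  expand : ∀ r y d B' g → (r + (r * y + d) * B') * g ≡ r * (g + y * (B' * g)) + d * (B' * g)
  expand = solve-∀
  open ≡-Reasoning
  k*g≡ : k * g ≡ r * x * A + d * B
  k*g≡ = begin
    k * g                                 ≡⟨ cong (_* g) (m≡m%n+[m/n]*n k B') ⟩
    (r + q * B') * g                      ≡⟨ cong (λ z → (r + z * B') * g) (sym (m+[n∸m]≡n ry≤q)) ⟩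
    (r + (r * y + d) * B') * g            ≡⟨ expand r y d B' g ⟩
    r * (g + y * (B' * g)) + d * (B' * g) ≡⟨ cong (λ z → r * (g + y * z) + d * z) (sym B≡B'g) ⟩
    r * (g + y * B) + d * B               ≡⟨ cong (λ z → r * z + d * B) bézout ⟩
    r * (x * A) + d * B                   ≡⟨ cong (_+ d * B) (sym (*-assoc r x A)) ⟩
    r * x * A + d * B                     ∎

quotient-nonZero : ∀ {B q g} → 0 < B → B ≡ q * g → NonZero q
quotient-nonZero {q = suc _} _   _    = _
quotient-nonZero {q = zero}  0<0 refl with () ← 0<0

gcd-multiples-eventually-combinations : ∀ A B → 0 < A → 0 < B →
  ∃[ K ] (∀ k → K ≤ k → Combination A B (k * gcd A B))
gcd-multiples-eventually-combinations A B A>0 B>0 with Bézout.identity (gcd-GCD A B)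
... | Bézout.+- x y eq with gcd[m,n]∣n A B
...   | divides B' B≡ = _ , bézout⇒eventually-combination {A} {B} {gcd A B} {x} {y} {B'}
                              {{quotient-nonZero B>0 B≡}} eq B≡
gcd-multiples-eventually-combinations A B A>0 B>0 | Bézout.-+ x y eq with gcd[m,n]∣m A B
...   | divides A' A≡ = _ , λ k k≥ → Combination-comm (bézout⇒eventually-combination
                              {B} {A} {gcd A B} {y} {x} {A'} {{quotient-nonZero A>0 A≡}} eq A≡ k k≥)

module Positions (SL SR : List ℕ) where

  entry : ℕ → Entry
  entry n = headEntry (history SL SR n)

  leftWins rightWins : ℕ → Bool
  leftWins n = proj₁ (entry n)
  rightWins n = proj₂ (entry n)

  WinningMove : (Entry → Bool) → ℕ → ℕ → Set
  WinningMove opp n s = 0 < s × ∃[ m ] (n ≡ s + m × opp (entry m) ≡ false)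

  nth-history : ∀ {n k} → k ≤ n → nth (history SL SR n) k ≡ just (entry (n ∸ k))
  nth-history {zero}  z≤n     = refl
  nth-history {suc n} z≤n     = refl
  nth-history {suc n} (s≤s p) = nth-history p

  nth-history-> : ∀ {n k} → n < k → nth (history SL SR n) k ≡ nothing
  nth-history-> {zero}  {suc k} _       = refl
  nth-history-> {suc n} {suc k} (s≤s p) = nth-history-> p

  no-move-from-0 : ∀ {opp s} → ¬ WinningMove opp 0 s
  no-move-from-0 {s = suc _} (_ , _ , () , _)

  move-remainder : ∀ {n s m} → n ≡ s + m → n ∸ s ≡ m
  move-remainder {s = s} {m} refl = m+n∸m≡n s m

  move-bound : ∀ {n s m} → n ≡ s + m → s ≤ n
  move-bound {s = s} {m} refl = m≤m+n s m

  canWin-history : ∀ opp S n →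
    canWin opp S (history SL SR n) ≡ true ⇔ Any (WinningMove opp (suc n)) S
  canWin-history opp []          n = mk⇔ (λ ()) (λ ())
  canWin-history opp (zero ∷ S)  n = mk⇔ (there ∘ to) λ where
      (here (() , _))
      (there w) → from w
    where open Equivalence (canWin-history opp S n)
  canWin-history opp (suc k ∷ S) n with k ≤? n
  ... | no k≰n rewrite nth-history-> (≰⇒> k≰n) = mk⇔ (there ∘ to) λ where
      (here (_ , _ , n≡k+m , _)) → ⊥-elim (k≰n (move-bound (suc-injective n≡k+m)))
      (there w) → from w
    where open Equivalence (canWin-history opp S n)
  ... | yes k≤n rewrite nth-history k≤n with opp (entry (n ∸ k)) in eq
  ...   | false =
    mk⇔ (const (here (z<s , n ∸ k , cong suc (sym (m+[n∸m]≡n k≤n)) , eq))) (const refl)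
  ...   | true  = mk⇔ (there ∘ to) λ where
      (here (_ , m , n≡k+m , lost)) → case trans (sym eq) (subst (λ x → opp (entry x) ≡ false)
        (sym (move-remainder {s = k} {m} (suc-injective n≡k+m))) lost) of λ ()
      (there w) → from w
    where open Equivalence (canWin-history opp S n)

  leftWins⇔ : ∀ n → leftWins n ≡ true ⇔ Any (WinningMove proj₂ n) SL
  leftWins⇔ zero    = mk⇔ (λ ()) (⊥-elim ∘ no-move-from-0 {proj₂} ∘ proj₂ ∘ satisfied)
  leftWins⇔ (suc n) = canWin-history proj₂ SL n

  rightWins⇔ : ∀ n → rightWins n ≡ true ⇔ Any (WinningMove proj₁ n) SR
  rightWins⇔ zero    = mk⇔ (λ ()) (⊥-elim ∘ no-move-from-0 {proj₁} ∘ proj₂ ∘ satisfied)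
  rightWins⇔ (suc n) = canWin-history proj₁ SR n

  leftWins-move : ∀ {s m} → s ∈ SL → 0 < s → rightWins m ≡ false → leftWins (s + m) ≡ true
  leftWins-move s∈SL s>0 lost =
    Equivalence.from (leftWins⇔ _) (lose s∈SL (s>0 , _ , refl , lost))

  leftWins-moves : ∀ {n} → leftWins n ≡ true →
    ∃[ s ] ∃[ m ] (s ∈ SL × 0 < s × n ≡ s + m × rightWins m ≡ false)
  leftWins-moves won with find (Equivalence.to (leftWins⇔ _) won)
  ... | s , s∈SL , s>0 , m , n≡s+m , lost = s , m , s∈SL , s>0 , n≡s+m , lost

InWindow : ℕ → ℕ → ℕ → Set
InWindow c n t = n < t × t ≤ n + c

inWindow-+ˡ : ∀ d {c n t} → InWindow c n t → InWindow c (d + n) (d + t)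
inWindow-+ˡ d {c} {n} {t} (n<t , t≤n+c) =
  +-monoʳ-< d n<t , subst (d + t ≤_) (sym (+-assoc d n c)) (+-monoʳ-≤ d t≤n+c)

inWindow-cancelˡ : ∀ d {c n t} → InWindow c (d + n) (d + t) → InWindow c n t
inWindow-cancelˡ d {c} {n} {t} (lt , le) =
  +-cancelˡ-< d n t lt , +-cancelˡ-≤ d t (n + c) (subst (d + t ≤_) (+-assoc d n c) le)

module SingleRightMove (SL : List ℕ) (c : ℕ) (c>0 : 0 < c) where
  open Positions SL (c ∷ []) public

  rightWins-< : ∀ {n} → n < c → rightWins n ≡ false
  rightWins-< n<c = ¬-not λ won → case Equivalence.to (rightWins⇔ _) won of λ where
    (here (_ , _ , n≡c+m , _)) → <⇒≱ n<c (move-bound n≡c+m)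

  rightWins-c+ : ∀ m → rightWins (c + m) ≡ not (leftWins m)
  rightWins-c+ m with leftWins m in eq
  ... | false = Equivalence.from (rightWins⇔ _) (here (c>0 , m , refl , eq))
  ... | true  = ¬-not λ won → case Equivalence.to (rightWins⇔ _) won of λ where
    (here (_ , m′ , c+m≡c+m′ , lost)) → case trans (sym eq) (subst (λ x → leftWins x ≡ false)
      (sym (+-cancelˡ-≡ c m m′ c+m≡c+m′)) lost) of λ ()

  LeftWinsAfterReply : ℕ → Set
  LeftWinsAfterReply m = m < c ⊎ ∃[ k ] (m ≡ c + k × leftWins k ≡ true)

  rightWins≡false⇔ : ∀ m → rightWins m ≡ false ⇔ LeftWinsAfterReply m
  rightWins≡false⇔ m = mk⇔ to λ where
      (inj₁ m<c)              → rightWins-< m<c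
      (inj₂ (k , refl , won)) → trans (rightWins-c+ k) (cong not won)
    where
    to : rightWins m ≡ false → LeftWinsAfterReply m
    to lost with <⊎∃+ c m
    ... | inj₁ m<c        = inj₁ m<c
    ... | inj₂ (k , refl) = inj₂ (k , refl , not-injective (trans (sym (rightWins-c+ k)) lost))

  Cycle : ℕ → Set
  Cycle t = ∃[ s ] (s ∈ SL × 0 < s × t ≡ s + c)

  Window : ℕ → Set
  Window n = ∃[ t ] (SumOf Cycle t × InWindow c n t)

  window⇒leftWins : ∀ {n t} → SumOf Cycle t → InWindow c n t → leftWins n ≡ true
  window⇒leftWins [] (() , _)
  window⇒leftWins {n} (_∷_ {t = t} (s , s∈SL , s>0 , refl) σ) w@(_ , t≤n+c)
    with m≤n⇒∃[o]m+o≡n (+-cancelʳ-≤ c s n (≤-trans (m≤m+n (s + c) t) t≤n+c))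
  ... | m , refl = leftWins-move s∈SL s>0 (Equivalence.from (rightWins≡false⇔ m) reply)
    where
    reply : LeftWinsAfterReply m
    reply with <⊎∃+ c m
    ... | inj₁ m<c        = inj₁ m<c
    ... | inj₂ (k , refl) = inj₂ (k , refl , window⇒leftWins σ (inWindow-cancelˡ (s + c)
          (subst (λ x → InWindow c x (s + c + t)) (sym (+-assoc s c k)) w)))

  leftWins⇒window : ∀ n → leftWins n ≡ true → Window n
  leftWins⇒window = <-rec (λ n → leftWins n ≡ true → Window n) step
    where
    step : ∀ n → (∀ {m} → m < n → leftWins m ≡ true → Window m) → leftWins n ≡ true → Window n
    step n rec won with leftWins-moves {n} won
    ... | s , m , s∈SL , s>0 , refl , lost with Equivalence.to (rightWins≡false⇔ m) lost
    ...   | inj₁ m<c = s + c + 0 , (s , s∈SL , s>0 , refl) ∷ [] ,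
            subst (InWindow c (s + m)) (sym (+-identityʳ (s + c))) (inWindow-+ˡ s (m<c , m≤n+m c m))
    ...   | inj₂ (k , refl , won′) with rec (≤-<-trans (m≤n+m k c) (m<n+m (c + k) s>0)) won′
    ...     | t , σ , w = s + c + t , (s , s∈SL , s>0 , refl) ∷ σ ,
              subst (λ x → InWindow c x (s + c + t)) (+-assoc s c k) (inWindow-+ˡ (s + c) w)

module EventuallyPeriodic (o : ℕ → Outcome) (g : ℕ) {{_ : NonZero g}} (Q : ℕ)
  (F : ℕ → Outcome) (o≡F : ∀ {q r} → Q ≤ q → r < g → o (q * g + r) ≡ F r) where

  n₀ : ℕ
  n₀ = Q * g

  o≡F-eventually : ∀ {n} → n₀ ≤ n → ∃[ r ] (r < g × o n ≡ F r)
  o≡F-eventually n≥n₀ with divMod-≥ g {Q} n≥n₀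
  ... | q , r , Q≤q , r<g , refl = r , r<g , o≡F Q≤q r<g

  o≡F-attained : ∀ {r} → r < g → n₀ ≤ n₀ + r × o (n₀ + r) ≡ F r
  o≡F-attained {r} r<g = m≤m+n n₀ r , o≡F ≤-refl r<g

  periodic : PeriodicFrom o n₀ g
  periodic = >-nonZero⁻¹ g , o-+g
    where
    o-+g : ∀ n → n₀ ≤ n → o (n + g) ≡ o n
    o-+g n n≥n₀ with divMod-≥ g {Q} n≥n₀
    ... | q , r , Q≤q , r<g , refl = begin
      o (q * g + r + g)   ≡⟨ cong o (shift q r g) ⟩
      o (suc q * g + r)   ≡⟨ o≡F (≤-trans Q≤q (n≤1+n q)) r<g ⟩
      F r                 ≡⟨ sym (o≡F Q≤q r<g) ⟩
      o (q * g + r)       ∎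
      where
      open ≡-Reasoning
      shift : ∀ q r g → q * g + r + g ≡ suc q * g + r
      shift = solve-∀

  hasPeriodWord : HasPeriodWord o (applyUpTo F g)
  hasPeriodWord rewrite length-applyUpTo F g = >-nonZero⁻¹ g , n₀ , λ k i i<g →
    trans (nth-applyUpTo F i<g)
          (cong just (sym (trans (cong o (regroup Q k i g)) (o≡F (m≤m+n Q k) i<g))))
    where
    regroup : ∀ Q k i g → Q * g + k * g + i ≡ (Q + k) * g + i
    regroup = solve-∀

  weaklyLeft : ∀ {r} → r < g → F r ≡ 𝓛 → (∀ r → r < g → F r ≢ 𝓡) → WeaklyLeft o
  weaklyLeft r<g Fr≡𝓛 no𝓡 = n₀ , g , periodic ,
    (_ , proj₁ (o≡F-attained r<g) , trans (proj₂ (o≡F-attained r<g)) Fr≡𝓛) ,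
    λ n n≥n₀ → let r , r<g , on≡Fr = o≡F-eventually n≥n₀ in no𝓡 r r<g ∘ trans (sym on≡Fr)

  weaklyRight : ∀ {r} → r < g → F r ≡ 𝓡 → (∀ r → r < g → F r ≢ 𝓛) → WeaklyRight o
  weaklyRight r<g Fr≡𝓡 no𝓛 = n₀ , g , periodic ,
    (_ , proj₁ (o≡F-attained r<g) , trans (proj₂ (o≡F-attained r<g)) Fr≡𝓡) ,
    λ n n≥n₀ → let r , r<g , on≡Fr = o≡F-eventually n≥n₀ in no𝓛 r r<g ∘ trans (sym on≡Fr)

  ultImpartial : (∀ r → r < g → F r ≢ 𝓛 × F r ≢ 𝓡) → UltImpartial o
  ultImpartial neither = n₀ , g , periodic ,
    λ n n≥n₀ → let r , r<g , on≡Fr = o≡F-eventually n≥n₀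
                   no𝓛 , no𝓡 = neither r r<g
               in no𝓛 ∘ trans (sym on≡Fr) , no𝓡 ∘ trans (sym on≡Fr)

-- The gcd is passed as a variable g so that goals mentioning q * g do not unfold gcd.
module TwoLeftMovesOneRightMove (a b c : ℕ) (a>0 : 0 < a) (b>0 : 0 < b) (c>0 : 0 < c)
  (g : ℕ) (g≡gcd : g ≡ gcd (a + c) (b + c)) where
  open SingleRightMove (a ∷ b ∷ []) c c>0

  instance
    g≢0 : NonZero g
    g≢0 = ≢-nonZero (subst (_≢ 0) (sym g≡gcd)
      (gcd[m,n]≢0 (a + c) (b + c) (inj₂ (n>0⇒n≢0 (m≤n⇒m≤o+n b c>0)))))

  o : ℕ → Outcome
  o = outcome (a ∷ b ∷ []) (c ∷ [])

  g∣cycle : ∀ {t} → Cycle t → g ∣ t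
  g∣cycle (_ , here refl , _ , refl) =
    subst (_∣ a + c) (sym g≡gcd) (gcd[m,n]∣m (a + c) (b + c))
  g∣cycle (_ , there (here refl) , _ , refl) =
    subst (_∣ b + c) (sym g≡gcd) (gcd[m,n]∣n (a + c) (b + c))

  eventuallyCombinations : ∃[ K ] (∀ k → K ≤ k → Combination (a + c) (b + c) (k * g))
  eventuallyCombinations =
    subst (λ d → ∃[ K ] (∀ k → K ≤ k → Combination (a + c) (b + c) (k * d))) (sym g≡gcd)
      (gcd-multiples-eventually-combinations (a + c) (b + c) (m≤n⇒m≤o+n a c>0) (m≤n⇒m≤o+n b c>0))

  K : ℕ
  K = proj₁ eventuallyCombinations

  leftWins-high : ∀ {q r} → K ≤ q → r < g → g ≤ r + c → leftWins (q * g + r) ≡ true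
  leftWins-high {q} {r} K≤q r<g g≤r+c with proj₂ eventuallyCombinations (suc q) (m≤n⇒m≤1+n K≤q)
  ... | u , v , sq*g≡ =
    window⇒leftWins sum (subst (InWindow c (q * g + r)) top (inWindow-+ˡ (q * g) (r<g , g≤r+c)))
    where
    sum : SumOf Cycle (u * (a + c) + v * (b + c))
    sum = SumOf-combination (a , here refl , a>0 , refl) (b , there (here refl) , b>0 , refl) u v
    top : q * g + g ≡ u * (a + c) + v * (b + c)
    top = trans (+-comm (q * g) g) sq*g≡

  multiple-in-window : ∀ {q r k} → InWindow c (q * g + r) (k * g) → g ≤ r + c
  multiple-in-window {q} {r} {k} (lt , le) = +-cancelˡ-≤ (q * g) g (r + c) (begin
    q * g + g     ≡⟨ +-comm (q * g) g ⟩
    suc q * g     ≤⟨ *-monoˡ-≤ g (*-cancelʳ-< g q k (≤-<-trans (m≤m+n (q * g) r) lt)) ⟩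
    k * g         ≤⟨ le ⟩
    q * g + r + c ≡⟨ +-assoc (q * g) r c ⟩
    q * g + (r + c) ∎)
    where open ≤-Reasoning

  leftWins-low : ∀ q {r} → r + c < g → leftWins (q * g + r) ≡ false
  leftWins-low q {r} r+c<g = ¬-not λ won → case leftWins⇒window (q * g + r) won of λ where
    (t , σ , w) → case SumOf-∣ g∣cycle σ of λ where
      (divides k refl) → <⇒≱ r+c<g (multiple-in-window {q} {r} {k} w)

  leftWins-eventually : ∀ {q r} → K ≤ q → r < g → leftWins (q * g + r) ≡ does (g ≤? r + c)
  leftWins-eventually {q} {r} K≤q r<g with g ≤? r + c
  ... | yes g≤r+c = trans (leftWins-high K≤q r<g g≤r+c) (sym (dec-true (g ≤? r + c) g≤r+c))
  ... | no  g≰r+c = trans (leftWins-low q (≰⇒> g≰r+c)) (sym (dec-false (g ≤? r + c) g≰r+c))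

  rightWins-eventually : c ≤ g → ∀ {q r} → suc K ≤ q → r < g →
    rightWins (q * g + r) ≡ does (c ≤? r)
  rightWins-eventually c≤g {q} {r} sK≤q r<g with c ≤? r
  ... | yes c≤r with m≤n⇒∃[o]m+o≡n c≤r
  ...   | k , refl = begin
    rightWins (q * g + (c + k)) ≡⟨ cong rightWins (swap (q * g) c k) ⟩
    rightWins (c + (q * g + k)) ≡⟨ rightWins-c+ (q * g + k) ⟩
    not (leftWins (q * g + k))  ≡⟨ cong not (leftWins-low q (subst (_< g) (+-comm c k) r<g)) ⟩
    true                        ≡⟨ dec-true (c ≤? c + k) c≤r ⟨
    does (c ≤? c + k)           ∎
    where
    open ≡-Reasoning
    swap : ∀ x c k → x + (c + k) ≡ c + (x + k)
    swap = solve-∀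
  rightWins-eventually c≤g {suc q} {r} (s≤s K≤q) r<g | no c≰r = begin
    rightWins (suc q * g + r)   ≡⟨ cong rightWins regroup ⟩
    rightWins (c + (q * g + e)) ≡⟨ rightWins-c+ (q * g + e) ⟩
    not (leftWins (q * g + e))  ≡⟨ cong not (leftWins-high K≤q e<g g≤e+c) ⟩
    false                       ≡⟨ dec-false (c ≤? r) c≰r ⟨
    does (c ≤? r)               ∎
    where
    open ≡-Reasoning
    e = g ∸ c + r
    c+[g∸c]≡g : c + (g ∸ c) ≡ g
    c+[g∸c]≡g = m+[n∸m]≡n c≤g
    e<g : e < g
    e<g = subst (e <_) (trans (+-comm (g ∸ c) c) c+[g∸c]≡g) (+-monoʳ-< (g ∸ c) (≰⇒> c≰r))
    g≤e+c : g ≤ e + c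
    g≤e+c = subst (_≤ e + c) (m∸n+n≡m c≤g) (+-monoˡ-≤ c (m≤m+n (g ∸ c) r))
    reassociate : ∀ c d x r → c + d + x + r ≡ c + (x + (d + r))
    reassociate = solve-∀
    regroup : suc q * g + r ≡ c + (q * g + e)
    regroup =
      trans (cong (λ x → x + q * g + r) (sym c+[g∸c]≡g)) (reassociate c (g ∸ c) (q * g) r)

  periodOutcome : ℕ → Outcome
  periodOutcome r = entryToOutcome (does (g ≤? r + c) , does (c ≤? r))

  outcome-eventually : c ≤ g → ∀ {q r} → suc K ≤ q → r < g → o (q * g + r) ≡ periodOutcome r
  outcome-eventually c≤g sK≤q r<g = cong₂ (λ x y → entryToOutcome (x , y))
    (leftWins-eventually (≤-trans (n≤1+n K) sK≤q) r<g) (rightWins-eventually c≤g sK≤q r<g)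

  module _ {r : ℕ} where
    periodOutcome-𝓟 : r < c → r + c < g → periodOutcome r ≡ 𝓟
    periodOutcome-𝓟 r<c r+c<g rewrite
      dec-false (g ≤? r + c) (<⇒≱ r+c<g) | dec-false (c ≤? r) (<⇒≱ r<c) = refl

    periodOutcome-𝓛 : r < c → g ≤ r + c → periodOutcome r ≡ 𝓛
    periodOutcome-𝓛 r<c g≤r+c rewrite
      dec-true (g ≤? r + c) g≤r+c | dec-false (c ≤? r) (<⇒≱ r<c) = refl

    periodOutcome-𝓡 : c ≤ r → r + c < g → periodOutcome r ≡ 𝓡
    periodOutcome-𝓡 c≤r r+c<g rewrite
      dec-false (g ≤? r + c) (<⇒≱ r+c<g) | dec-true (c ≤? r) c≤r = refl

    periodOutcome-𝓝 : c ≤ r → g ≤ r + c → periodOutcome r ≡ 𝓝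
    periodOutcome-𝓝 c≤r g≤r+c rewrite
      dec-true (g ≤? r + c) g≤r+c | dec-true (c ≤? r) c≤r = refl

    periodOutcome≡𝓛 : periodOutcome r ≡ 𝓛 → r < c × g ≤ r + c
    periodOutcome≡𝓛 eq with c ≤? r | g ≤? r + c
    ... | no c≰r  | yes g≤r+c = ≰⇒> c≰r , g≤r+c
    ... | no c≰r  | no g≰r+c  = case trans (sym eq) (periodOutcome-𝓟 (≰⇒> c≰r) (≰⇒> g≰r+c)) of λ ()
    ... | yes c≤r | no g≰r+c  = case trans (sym eq) (periodOutcome-𝓡 c≤r (≰⇒> g≰r+c)) of λ ()
    ... | yes c≤r | yes g≤r+c = case trans (sym eq) (periodOutcome-𝓝 c≤r g≤r+c) of λ ()

    periodOutcome≡𝓡 : periodOutcome r ≡ 𝓡 → c ≤ r × r + c < g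
    periodOutcome≡𝓡 eq with c ≤? r | g ≤? r + c
    ... | yes c≤r | no g≰r+c  = c≤r , ≰⇒> g≰r+c
    ... | no c≰r  | no g≰r+c  = case trans (sym eq) (periodOutcome-𝓟 (≰⇒> c≰r) (≰⇒> g≰r+c)) of λ ()
    ... | no c≰r  | yes g≤r+c = case trans (sym eq) (periodOutcome-𝓛 (≰⇒> c≰r) g≤r+c) of λ ()
    ... | yes c≤r | yes g≤r+c = case trans (sym eq) (periodOutcome-𝓝 c≤r g≤r+c) of λ ()

  leftWins-beyond : g ≤ c → ∀ {n} → K * g ≤ n → leftWins n ≡ true
  leftWins-beyond g≤c n≥Kg with divMod-≥ g {K} n≥Kg
  ... | q , r , K≤q , r<g , refl = leftWins-high K≤q r<g (≤-trans g≤c (m≤n+m c r))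

  stronglyLeft : g ≤ c → StronglyLeft o
  stronglyLeft g≤c = c + K * g , o≡𝓛
    where
    o≡𝓛 : ∀ n → c + K * g ≤ n → o n ≡ 𝓛
    o≡𝓛 n n≥ with m≤n⇒∃[o]m+o≡n n≥
    ... | j , refl = cong₂ (λ x y → entryToOutcome (x , y))
      (leftWins-beyond g≤c (≤-trans (m≤n+m (K * g) c) (m≤m+n _ j)))
      (begin
        rightWins (c + K * g + j)   ≡⟨ cong rightWins (+-assoc c (K * g) j) ⟩
        rightWins (c + (K * g + j)) ≡⟨ rightWins-c+ (K * g + j) ⟩
        not (leftWins (K * g + j))  ≡⟨ cong not (leftWins-beyond g≤c (m≤m+n (K * g) j)) ⟩
        false                       ∎)
      where open ≡-Reasoning

  module Periodic (c≤g : c ≤ g) =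
    EventuallyPeriodic o g (suc K) periodOutcome (outcome-eventually c≤g)

  weaklyLeftCase : c < g → g < 2 * c →
    WeaklyLeft o × HasPeriodWord o ((𝓟 ^ʷ (g ∸ c)) ++ (𝓛 ^ʷ (2 * c ∸ g)) ++ (𝓝 ^ʷ (g ∸ c)))
  weaklyLeftCase c<g g<2c =
    weaklyLeft p<g (periodOutcome-𝓛 p<c (≤-reflexive (sym p+c≡g))) no𝓡 ,
    subst (HasPeriodWord o) word hasPeriodWord
    where
    open Periodic (<⇒≤ c<g)
    p = g ∸ c
    q = 2 * c ∸ g
    c+p≡g : c + p ≡ g
    c+p≡g = m+[n∸m]≡n (<⇒≤ c<g)
    p+c≡g : p + c ≡ g
    p+c≡g = trans (+-comm p c) c+p≡g
    g<c+c : g < c + c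
    g<c+c = subst (g <_) (2*c≡c+c c) g<2c
    p+q≡c : p + q ≡ c
    p+q≡c = +-cancelˡ-≡ c (p + q) c (begin
      c + (p + q) ≡⟨ +-assoc c p q ⟨
      c + p + q   ≡⟨ cong (_+ q) c+p≡g ⟩
      g + q       ≡⟨ m+[n∸m]≡n (<⇒≤ g<2c) ⟩
      2 * c       ≡⟨ 2*c≡c+c c ⟩
      c + c       ∎)
      where open ≡-Reasoning
    p<c : p < c
    p<c = +-cancelˡ-< c p c (subst (_< c + c) (sym c+p≡g) g<c+c)
    p<g : p < g
    p<g = <-trans p<c c<g
    no𝓡 : ∀ r → r < g → periodOutcome r ≢ 𝓡
    no𝓡 r _ eq = let c≤r , r+c<g = periodOutcome≡𝓡 eq
                 in <-asym g<c+c (≤-<-trans (+-monoˡ-≤ c c≤r) r+c<g)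
    word : applyUpTo periodOutcome g ≡ (𝓟 ^ʷ p) ++ (𝓛 ^ʷ q) ++ (𝓝 ^ʷ p)
    word = trans (cong (applyUpTo periodOutcome) (sym length≡g)) (applyUpTo-blocks p q p
      (λ i i<p → periodOutcome-𝓟 (<-≤-trans i<p (subst (p ≤_) p+q≡c (m≤m+n p q)))
                                 (subst (i + c <_) p+c≡g (+-monoˡ-< c i<p)))
      (λ i i<q → periodOutcome-𝓛 (subst (p + i <_) p+q≡c (+-monoʳ-< p i<q))
                                 (subst (_≤ p + i + c) p+c≡g (+-monoˡ-≤ c (m≤m+n p i))))
      (λ i _ → periodOutcome-𝓝 (subst (_≤ p + (q + i)) p+q≡c (+-monoʳ-≤ p (m≤m+n q i)))
                               (subst (_≤ p + (q + i) + c) p+c≡g (+-monoˡ-≤ c (m≤m+n p (q + i))))))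
      where
      length≡g : p + (q + p) ≡ g
      length≡g = trans (sym (+-assoc p q p)) (trans (cong (_+ p) p+q≡c) c+p≡g)

  impartialCase : g ≡ 2 * c → UltImpartial o × HasPeriodWord o ((𝓟 ^ʷ c) ++ (𝓝 ^ʷ c))
  impartialCase g≡2c = ultImpartial neither , subst (HasPeriodWord o) word hasPeriodWord
    where
    g≡c+c : g ≡ c + c
    g≡c+c = trans g≡2c (2*c≡c+c c)
    open Periodic (subst (c ≤_) (sym g≡c+c) (m≤m+n c c))
    neither : ∀ r → r < g → periodOutcome r ≢ 𝓛 × periodOutcome r ≢ 𝓡
    neither r _ =
      (λ eq → let r<c , g≤r+c = periodOutcome≡𝓛 eq
              in <⇒≱ r<c (+-cancelʳ-≤ c c r (subst (_≤ r + c) g≡c+c g≤r+c))) ,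
      (λ eq → let c≤r , r+c<g = periodOutcome≡𝓡 eq
              in <⇒≱ (+-cancelʳ-< c r c (subst (r + c <_) g≡c+c r+c<g)) c≤r)
    word : applyUpTo periodOutcome g ≡ (𝓟 ^ʷ c) ++ (𝓝 ^ʷ c)
    word = begin
      applyUpTo periodOutcome g
        ≡⟨ cong (applyUpTo periodOutcome) g≡c+c ⟩
      applyUpTo periodOutcome (c + c)
        ≡⟨ applyUpTo-replicate-++ c c (λ i i<c →
             periodOutcome-𝓟 i<c (subst (i + c <_) (sym g≡c+c) (+-monoˡ-< c i<c))) ⟩
      replicate c 𝓟 ++ applyUpTo (periodOutcome ∘ (c +_)) c
        ≡⟨ cong (replicate c 𝓟 ++_) (applyUpTo-replicate c λ i _ →
             periodOutcome-𝓝 (m≤m+n c i) (subst (_≤ c + i + c) (sym g≡c+c) (+-monoˡ-≤ c (m≤m+n c i)))) ⟩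
      replicate c 𝓟 ++ replicate c 𝓝
        ∎
      where open ≡-Reasoning

  weaklyRightCase : 2 * c < g →
    WeaklyRight o × HasPeriodWord o ((𝓟 ^ʷ c) ++ (𝓡 ^ʷ (g ∸ 2 * c)) ++ (𝓝 ^ʷ c))
  weaklyRightCase 2c<g =
    weaklyRight c<g (periodOutcome-𝓡 ≤-refl c+c<g) no𝓛 ,
    subst (HasPeriodWord o) word hasPeriodWord
    where
    q = g ∸ 2 * c
    c+c<g : c + c < g
    c+c<g = subst (_< g) (2*c≡c+c c) 2c<g
    c<g : c < g
    c<g = ≤-<-trans (m≤m+n c c) c+c<g
    open Periodic (<⇒≤ c<g)
    c+c+q≡g : c + c + q ≡ g
    c+c+q≡g = trans (cong (_+ q) (sym (2*c≡c+c c))) (m+[n∸m]≡n (<⇒≤ 2c<g))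
    no𝓛 : ∀ r → r < g → periodOutcome r ≢ 𝓛
    no𝓛 r _ eq = let r<c , g≤r+c = periodOutcome≡𝓛 eq
                 in <⇒≱ c+c<g (≤-trans g≤r+c (+-monoˡ-≤ c (<⇒≤ r<c)))
    rearrange₁ : ∀ c i → c + c + i ≡ c + i + c
    rearrange₁ = solve-∀
    rearrange₂ : ∀ c q i → c + c + q + i ≡ c + (q + i) + c
    rearrange₂ = solve-∀
    rearrange₃ : ∀ c q → c + c + q ≡ c + (q + c)
    rearrange₃ = solve-∀
    word : applyUpTo periodOutcome g ≡ (𝓟 ^ʷ c) ++ (𝓡 ^ʷ q) ++ (𝓝 ^ʷ c)
    word = trans (cong (applyUpTo periodOutcome) (trans (sym c+c+q≡g) (rearrange₃ c q)))
                 (applyUpTo-blocks c q c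
      (λ i i<c → periodOutcome-𝓟 i<c (<-trans (+-monoˡ-< c i<c) c+c<g))
      (λ i i<q → periodOutcome-𝓡 (m≤m+n c i) (subst₂ _<_ (rearrange₁ c i) c+c+q≡g
                                                (+-monoʳ-< (c + c) i<q)))
      (λ i _ → periodOutcome-𝓝 (m≤m+n c (q + i))
                 (subst₂ _≤_ c+c+q≡g (rearrange₂ c q i) (m≤m+n (c + c + q) i))))

mainTheorem10 : (a b c : ℕ) → 0 < a → 0 < b → 0 < c →
    let g = gcd (a + c) (b + c)
        o = outcome (a ∷ b ∷ []) (c ∷ [])
    in (g ≤ c → StronglyLeft o)
     × (c < g → g < 2 * c →
          WeaklyLeft o × HasPeriodWord o ((𝓟 ^ʷ (g ∸ c)) ++ (𝓛 ^ʷ (2 * c ∸ g)) ++ (𝓝 ^ʷ (g ∸ c))))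
     × (g ≡ 2 * c →
          UltImpartial o × HasPeriodWord o ((𝓟 ^ʷ c) ++ (𝓝 ^ʷ c)))
     × (2 * c < g →
          WeaklyRight o × HasPeriodWord o ((𝓟 ^ʷ c) ++ (𝓡 ^ʷ (g ∸ 2 * c)) ++ (𝓝 ^ʷ c)))
mainTheorem10 a b c a>0 b>0 c>0 = stronglyLeft , weaklyLeftCase , impartialCase , weaklyRightCase
  where open TwoLeftMovesOneRightMove a b c a>0 b>0 c>0 (gcd (a + c) (b + c)) refl
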